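{- Let $G$ be a connected graph. Then $\rho(G)=0$ if and only if $G$ is a caterpillar.
   Context: A caterpillar is a tree in which every vertex is within distance $1$ of some fixed path (the backbone). Patrol game with radius of capture $\rho\ge 0$ on a connected graph $G$: there is one cop and one robber. Before the game the cop fixes a walk in $G$ (his patrol: a sequence of vertices in which consecutive vertices are equal or adjacent), and the robber knows the entire patrol in advance, while the cop has no information about the robber. The cop starts at the first vertex of his patrol, then the robber chooses a starting vertex; afterwards the players alternate moves (cop first), the cop following his patrol and the robber moving to an adjacent vertex or staying put. The cop wins if at some moment the distance between the cop and the robber is at most $\rho$; otherwise the robber wins. $\rho(G)$ is the minimum $\rho\ge0$ for which the cop has a patrol capturing the robber regardless of the robber's play. -}

module Defs where

open import Data.Nat using (ℕ; zero; suc; _≤_; _<_; _+_)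
open import Data.Fin using (Fin)
open import Data.List using (List; []; _∷_; _++_; [_]; length)
open import Data.List.Relation.Unary.Linked using (Linked)
open import Data.List.Relation.Unary.Unique.Propositional using (Unique)
open import Data.List.Relation.Unary.Any using (Any)
open import Data.Product using (Σ; ∃; ∃-syntax; _×_)
open import Data.Sum using (_⊎_)
open import Data.Empty using (⊥)
open import Relation.Nullary using (¬_; Dec)
open import Relation.Binary.PropositionalEquality using (_≡_)

record Graph : Set₁ where
  field
    n     : ℕ
    Adj   : Fin n → Fin n → Set
    adj?  : ∀ u v → Dec (Adj u v)
    sym   : ∀ {u v} → Adj u v → Adj v u
    irrefl : ∀ {u} → ¬ Adj u u

module _ (G : Graph) where
  open Graph G

  Vertex : Set
  Vertex = Fin n

  data Walk : Vertex → Vertex → ℕ → Set where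
    here : ∀ {u} → Walk u u zero
    step : ∀ {u v w k} → Adj u v → Walk v w k → Walk u w (suc k)

  DistLe : Vertex → Vertex → ℕ → Set
  DistLe u v r = ∃[ k ] (k ≤ r × Walk u v k)

  Connected : Set
  Connected = (0 < n) × (∀ u v → ∃[ k ] Walk u v k)

  -- a cycle: distinct vertices x ∷ xs, at least 3 of them, consecutive ones
  -- adjacent, and the last adjacent to x
  IsCycle : Vertex → List Vertex → Set
  IsCycle x xs = (2 ≤ length xs) × Unique (x ∷ xs) × Linked Adj (x ∷ xs ++ [ x ])

  Acyclic : Set
  Acyclic = ∀ x xs → ¬ IsCycle x xs

  IsTree : Set
  IsTree = Connected × Acyclic

  IsPath : List Vertex → Set
  IsPath p = (0 < length p) × Unique p × Linked Adj p

  Dominates : List Vertex → Set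
  Dominates p = ∀ v → Any (λ w → v ≡ w ⊎ Adj v w) p

  IsCaterpillar : Set
  IsCaterpillar = IsTree × Σ (List Vertex) (λ p → IsPath p × Dominates p)

  LazyWalk : ℕ → (ℕ → Vertex) → Set
  LazyWalk T x = ∀ i → i < T → x i ≡ x (suc i) ⊎ Adj (x i) (x (suc i))

  -- Cop follows patrol c 0 … c T.  Robber's (deterministic, since he knows
  -- the patrol) play is a lazy walk r 0 … r T: he starts at r 0 after the cop
  -- is placed at c 0; in round i+1 the cop moves to c (i+1) (while the robber
  -- is at r i), then the robber moves to r (i+1).  Capture occurs at some
  -- moment when dist(c i , r i) ≤ ρ or dist(c (i+1) , r i) ≤ ρ.
  Captures : ℕ → ℕ → (ℕ → Vertex) → (ℕ → Vertex) → Set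
  Captures ρ T c r =
    (∃[ i ] (i ≤ T × DistLe (c i) (r i) ρ)) ⊎
    (∃[ i ] (i < T × DistLe (c (suc i)) (r i) ρ))

  CopWins : ℕ → Set
  CopWins ρ = ∃[ T ] Σ (ℕ → Vertex) λ c →
    LazyWalk T c × (∀ r → LazyWalk T r → Captures ρ T c r)

  RhoIs : ℕ → Set
  RhoIs r = CopWins r × (∀ r' → CopWins r' → r ≤ r')

module Submission where

-- On a cycle the cop never catches the robber: every cycle vertex the cop does not occupy at time t can
-- hold an uncaught robber at time t, since if the cop occupied it at time t - 1 the robber arrives from
-- whichever of its two cycle neighbours the cop is not stepping onto.  Nor does he catch him on a spider
-- (three legs of length two at a common centre) inside a tree: the robber waits on a leaf, and while the
-- cop visits another leaf he stays at distance at least two from the centre, so at the last such visit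
-- before the cop comes for the robber's leaf the robber crosses to the third leaf.  In a tree without a
-- spider, a path that does not dominate the graph either extends or forms a spider with a vertex at
-- distance two from it; growing a path therefore ends in a caterpillar backbone.  Conversely, on a
-- caterpillar the cop walks along the backbone and makes a round trip into every leg: without cycles no
-- robber can get behind him, and a robber in a leg can only leave it through its backbone vertex.

open import Data.Empty using (⊥; ⊥-elim)
open import Data.Fin using (Fin; zero; suc; fromℕ<) renaming (_≟_ to _≟ᶠ_)
open import Data.Fin.Patterns using (0F; 1F; 2F)
open import Data.Fin.Properties using (any?; all?; ¬∀⟶∃¬; injective⇒≤)
open import Data.List using (List; []; _∷_; _++_; [_]; length; foldl; reverse; lookup; filter; allFin; initLast; _∷ʳ′_)
open import Data.List.Properties
  using ( foldl-++; ++-assoc; ∷-injectiveʳ; length-++; length-++-sucʳ; length-++-comm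
        ; reverse-++; unfold-reverse; length-reverse)
open import Data.List.Membership.Propositional using (_∈_; _∉_; find)
open import Data.List.Membership.Propositional.Properties
  using (∈-∃++; ∈-++⁺ʳ; ∈-++⁺ˡ; ∈-++⁻; ∈-lookup; ∈-filter⁺; ∈-allFin)
import Data.List.Membership.DecPropositional as DecMembership
open import Data.List.Relation.Binary.Disjoint.Propositional using (Disjoint)
open import Data.List.Relation.Binary.Permutation.Propositional using (↭⇒↭ₛ; ↭-sym)
open import Data.List.Relation.Binary.Permutation.Propositional.Properties using (++-comm; ∈-resp-↭; ↭-reverse)
import Data.List.Relation.Binary.Permutation.Setoid.Properties as Permₛ
open import Data.List.Relation.Unary.All using (All; []; _∷_)
import Data.List.Relation.Unary.All as All
import Data.List.Relation.Unary.All.Properties as Allₚ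
open import Data.List.Relation.Unary.AllPairs using ([]; _∷_)
import Data.List.Relation.Unary.AllPairs as AllPairs
open import Data.List.Relation.Unary.Any using (Any; here; there)
import Data.List.Relation.Unary.Any as Any
open import Data.List.Relation.Unary.Linked using (Linked; []; [-]; _∷_)
import Data.List.Relation.Unary.Linked as Linked
open import Data.List.Relation.Unary.Unique.Propositional using (Unique)
open import Data.List.Relation.Unary.Unique.Propositional.Properties using (Unique[x∷xs]⇒x∉xs)
import Data.List.Relation.Unary.Unique.Propositional.Properties as Unique
open import Data.Nat using (ℕ; zero; suc; _+_; _∸_; _≤_; _<_; z≤n; s≤s; _≤?_)
open import Data.Nat.Properties
open import Data.Product using (∃; ∃-syntax; _×_; _,_; proj₁; proj₂; map₁)
open import Data.Sum using (_⊎_; inj₁; inj₂)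
open import Data.Unit using (⊤; tt)
open import Function using (_∘_)
open import Function.Bundles using (_⇔_; mk⇔)
open import Relation.Binary.Definitions using (tri<; tri≈; tri>)
open import Relation.Binary.PropositionalEquality using (_≡_; _≢_; ≢-sym; refl; sym; trans; cong; subst; subst₂; setoid)
open import Relation.Nullary using (¬_; Dec; yes; no; ¬?; _×-dec_; _⊎-dec_)
open import Relation.Unary using (_⊆_)

open import Defs

module _ {A : Set} where

  Unique-++⁻ˡ : ∀ xs {ys : List A} → Unique (xs ++ ys) → Unique xs
  Unique-++⁻ˡ []       _           = []
  Unique-++⁻ˡ (x ∷ xs) (x∉ ∷ uniq) = Allₚ.++⁻ˡ xs x∉ ∷ Unique-++⁻ˡ xs uniq

  Unique-++⁻ʳ : ∀ xs {ys : List A} → Unique (xs ++ ys) → Unique ys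
  Unique-++⁻ʳ []       uniq       = uniq
  Unique-++⁻ʳ (x ∷ xs) (_ ∷ uniq) = Unique-++⁻ʳ xs uniq

  Unique-++-comm : ∀ xs ys → Unique (xs ++ ys) → Unique (ys ++ xs)
  Unique-++-comm xs ys = Permₛ.Unique-resp-↭ (setoid A) (↭⇒↭ₛ (++-comm xs ys))

  Unique-reverse : ∀ xs → Unique xs → Unique (reverse xs)
  Unique-reverse xs = Permₛ.Unique-resp-↭ (setoid A) (↭⇒↭ₛ (↭-sym (↭-reverse xs)))

  reverse-split : ∀ xs (x : A) ys → reverse (xs ++ x ∷ ys) ≡ reverse ys ++ x ∷ reverse xs
  reverse-split xs x ys =
    trans (reverse-++ xs (x ∷ ys))
      (trans (cong (_++ reverse xs) (unfold-reverse x ys)) (++-assoc (reverse ys) [ x ] (reverse xs)))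

  lookup-injective : ∀ {xs : List A} → Unique xs → ∀ {i j} → lookup xs i ≡ lookup xs j → i ≡ j
  lookup-injective {x ∷ xs} _    {zero}  {zero}  _  = refl
  lookup-injective {x ∷ xs} uniq {zero}  {suc j} eq =
    ⊥-elim (Unique[x∷xs]⇒x∉xs uniq (subst (_∈ xs) (sym eq) (∈-lookup j)))
  lookup-injective {x ∷ xs} uniq {suc i} {zero}  eq =
    ⊥-elim (Unique[x∷xs]⇒x∉xs uniq (subst (_∈ xs) eq (∈-lookup i)))
  lookup-injective {x ∷ xs} uniq {suc i} {suc j} eq = cong suc (lookup-injective (AllPairs.tail uniq) eq)

  ends-with-two : (xs : List A) → length xs ≤ 1 ⊎ ∃[ ys ] ∃[ b ] ∃[ a ] (xs ≡ ys ++ b ∷ a ∷ [])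
  ends-with-two []               = inj₁ z≤n
  ends-with-two (x ∷ [])         = inj₁ (s≤s z≤n)
  ends-with-two (x ∷ y ∷ [])     = inj₂ ([] , x , y , refl)
  ends-with-two (x ∷ y ∷ z ∷ xs) with ends-with-two (y ∷ z ∷ xs)
  ... | inj₁ (s≤s ())
  ... | inj₂ (ys , b , a , eq) = inj₂ (x ∷ ys , b , a , cong (x ∷_) eq)

  module _ {R : A → A → Set} where

    Linked-split : ∀ xs {x ys} → Linked R (xs ++ x ∷ ys) → Linked R (xs ++ [ x ]) × Linked R (x ∷ ys)
    Linked-split []           links       = [-] , links
    Linked-split (y ∷ [])     (r ∷ links) = r ∷ [-] , links
    Linked-split (y ∷ z ∷ xs) (r ∷ links) = map₁ (r ∷_) (Linked-split (z ∷ xs) links)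

    Linked-join : ∀ xs {x ys} → Linked R (xs ++ [ x ]) → Linked R (x ∷ ys) → Linked R (xs ++ x ∷ ys)
    Linked-join []           _           links = links
    Linked-join (y ∷ [])     (r ∷ [-])   links = r ∷ links
    Linked-join (y ∷ z ∷ xs) (r ∷ left)  links = r ∷ Linked-join (z ∷ xs) left links

    Linked-reverse : (∀ {a b} → R a b → R b a) → ∀ {xs} → Linked R xs → Linked R (reverse xs)
    Linked-reverse R-sym []  = []
    Linked-reverse R-sym [-] = [-]
    Linked-reverse R-sym {x ∷ y ∷ xs} (r ∷ links) =
      subst (Linked R) (sym (reverse-split [ x ] y xs))
        (Linked-join (reverse xs) (subst (Linked R) (unfold-reverse y xs) (Linked-reverse R-sym links)) (R-sym r ∷ [-]))

module _ {P : ℕ → Set} (P? : ∀ s → Dec (P s)) where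

  least-below : ∀ m → (∀ s → s < m → ¬ P s) ⊎ ∃[ τ ] (τ < m × P τ × (∀ s → s < τ → ¬ P s))
  least-below zero = inj₁ (λ _ ())
  least-below (suc m) with least-below m
  ... | inj₂ (τ , τ<m , Pτ , below) = inj₂ (τ , m<n⇒m<1+n τ<m , Pτ , below)
  ... | inj₁ none with P? m
  ...   | yes Pm = inj₂ (m , ≤-refl , Pm , none)
  ...   | no ¬Pm = inj₁ none′
    where
    none′ : ∀ s → s < suc m → ¬ P s
    none′ s (s≤s s≤m) with m≤n⇒m<n∨m≡n s≤m
    ... | inj₁ s<m  = none s s<m
    ... | inj₂ refl = ¬Pm

  greatest-below : ∀ {a σ₀} τ → a ≤ σ₀ → σ₀ < τ → P σ₀ →
             ∃[ σ ] (a ≤ σ × σ < τ × P σ × (∀ s → σ < s → s < τ → ¬ P s))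
  greatest-below (suc τ) a≤σ₀ (s≤s σ₀≤τ) Pσ₀ with P? τ
  ... | yes Pτ =
    τ , ≤-trans a≤σ₀ σ₀≤τ , ≤-refl , Pτ , (λ s τ<s s<1+τ → ⊥-elim (<⇒≱ τ<s (≤-pred s<1+τ)))
  ... | no ¬Pτ with m≤n⇒m<n∨m≡n σ₀≤τ
  ...   | inj₂ refl = ⊥-elim (¬Pτ Pσ₀)
  ...   | inj₁ σ₀<τ with greatest-below τ a≤σ₀ σ₀<τ Pσ₀
  ...     | σ , a≤σ , σ<τ , Pσ , above = σ , a≤σ , m<n⇒m<1+n σ<τ , Pσ , above′
    where
    above′ : ∀ s → σ < s → s < suc τ → ¬ P s
    above′ s σ<s (s≤s s≤τ) with m≤n⇒m<n∨m≡n s≤τ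
    ... | inj₁ s<τ  = above s σ<s s<τ
    ... | inj₂ refl = ¬Pτ

∃⊎∀ : ∀ {n} {A B : Fin n → Set} → (∀ i → A i ⊎ B i) → ∃ A ⊎ (∀ i → B i)
∃⊎∀ {zero}  _ = inj₂ (λ ())
∃⊎∀ {suc n} A⊎B with A⊎B zero | ∃⊎∀ (λ i → A⊎B (suc i))
... | inj₁ A0 | _ = inj₁ (zero , A0)
... | inj₂ _  | inj₁ (i , Ai) = inj₁ (suc i , Ai)
... | inj₂ B0 | inj₂ B = inj₂ (λ { zero → B0 ; (suc i) → B i })

third : ∀ (j m : Fin 3) → ∃[ k ] (k ≢ j × k ≢ m)
third 0F 0F = 1F , (λ ()) , (λ ())
third 0F 1F = 2F , (λ ()) , (λ ())
third 0F 2F = 1F , (λ ()) , (λ ())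
third 1F 0F = 2F , (λ ()) , (λ ())
third 1F 1F = 0F , (λ ()) , (λ ())
third 1F 2F = 0F , (λ ()) , (λ ())
third 2F 0F = 1F , (λ ()) , (λ ())
third 2F 1F = 0F , (λ ()) , (λ ())
third 2F 2F = 0F , (λ ()) , (λ ())

sort3 : (τ : Fin 3 → ℕ) → (∀ {p q} → p ≢ q → τ p ≢ τ q) →
        ∃[ l ] ∃[ m ] ∃[ j ] (τ l < τ m × τ m < τ j × l ≢ m × m ≢ j)
sort3 τ τ-inj with <-cmp (τ 0F) (τ 1F) | <-cmp (τ 1F) (τ 2F) | <-cmp (τ 0F) (τ 2F)
... | tri≈ _ eq _ | _ | _ = ⊥-elim (τ-inj (λ ()) eq)
... | _ | tri≈ _ eq _ | _ = ⊥-elim (τ-inj (λ ()) eq)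
... | _ | _ | tri≈ _ eq _ = ⊥-elim (τ-inj (λ ()) eq)
... | tri< a _ _ | tri< b _ _ | _         = 0F , 1F , 2F , a , b , (λ ()) , (λ ())
... | tri< a _ _ | tri> _ _ b | tri< c _ _ = 0F , 2F , 1F , c , b , (λ ()) , (λ ())
... | tri< a _ _ | tri> _ _ b | tri> _ _ c = 2F , 0F , 1F , c , a , (λ ()) , (λ ())
... | tri> _ _ a | tri< b _ _ | tri< c _ _ = 1F , 0F , 2F , a , c , (λ ()) , (λ ())
... | tri> _ _ a | tri< b _ _ | tri> _ _ c = 1F , 2F , 0F , b , c , (λ ()) , (λ ())
... | tri> _ _ a | tri> _ _ b | _         = 2F , 1F , 0F , b , a , (λ ()) , (λ ())

module _ (G : Graph) where
  open Graph G renaming (sym to adj-sym)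
  open DecMembership (_≟ᶠ_ {n}) using (_∈?_)

  private
    V : Set
    V = Vertex G

  -- The game at radius 0

  Near : V → V → Set
  Near u v = u ≡ v ⊎ Adj u v

  -- The robber's possible positions are tracked as a set: Next A w is where a robber who could be
  -- anywhere in A can be, uncaught, after the cop steps onto w and the robber makes his move.
  Next : (V → Set) → V → V → Set
  Next A w v = v ≢ w × ∃[ u ] (A u × u ≢ w × Near u v)

  Anywhere : V → Set
  Anywhere _ = ⊤

  Uncaught : (V → Set) → (ℕ → V) → ℕ → V → Set
  Uncaught A c zero    = Next A (c 0)
  Uncaught A c (suc t) = Next (Uncaught A c t) (c (suc t))

  Uncaught-move : ∀ {A c t u v} → Uncaught A c t u → Near u v → u ≢ c (suc t) → v ≢ c (suc t) →
                  Uncaught A c (suc t) v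
  Uncaught-move U u~v u≢c v≢c = v≢c , _ , U , u≢c , u~v

  Uncaught-stay : ∀ {A c t t′ v} → t ≤ t′ → (∀ s → t < s → s ≤ t′ → c s ≢ v) →
                  Uncaught A c t v → Uncaught A c t′ v
  Uncaught-stay {t′ = zero}   z≤n _ U = U
  Uncaught-stay {A} {c} {t′ = suc t′} {v} t≤t′ absent U with m≤n⇒m<n∨m≡n t≤t′
  ... | inj₂ refl = U
  ... | inj₁ (s≤s t≤t′) = Uncaught-move {t = t′} U′ (inj₁ refl) v≢c v≢c
    where
    U′ : Uncaught A c t′ v
    U′ = Uncaught-stay t≤t′ (λ s t<s s≤t′ → absent s t<s (m≤n⇒m≤1+n s≤t′)) U

    v≢c : v ≢ c (suc t′)
    v≢c = ≢-sym (absent (suc t′) (s≤s t≤t′) ≤-refl)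

  Evades : ℕ → (ℕ → V) → (ℕ → V) → Set
  Evades T c r = (∀ i → i ≤ T → r i ≢ c i) × (∀ i → i < T → r i ≢ c (suc i))

  evades⇒uncaught : ∀ {T c r} → LazyWalk G T r → Evades T c r →
                    ∀ t → t ≤ T → Uncaught Anywhere c t (r t)
  evades⇒uncaught {r = r} lw (≢c , ≢c⁺) zero _ =
    ≢c 0 z≤n , r 0 , tt , ≢c 0 z≤n , inj₁ refl
  evades⇒uncaught lw ev@(≢c , ≢c⁺) (suc t) t<T =
    ≢c (suc t) t<T , _ , evades⇒uncaught lw ev t (<⇒≤ t<T) , ≢c⁺ t t<T , lw t t<T

  extend : (ℕ → V) → ℕ → V → ℕ → V
  extend r t v i with i ≤? t
  ... | yes _ = r i
  ... | no  _ = v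

  extend-≤ : ∀ r t v {i} → i ≤ t → extend r t v i ≡ r i
  extend-≤ r t v {i} i≤t with i ≤? t
  ... | yes _   = refl
  ... | no  i≰t = ⊥-elim (i≰t i≤t)

  extend-suc : ∀ r t v → extend r t v (suc t) ≡ v
  extend-suc r t v with suc t ≤? t
  ... | yes t<t = ⊥-elim (<-irrefl refl t<t)
  ... | no  _   = refl

  uncaught⇒evades : ∀ {c} t v → Uncaught Anywhere c t v →
                    ∃[ r ] (LazyWalk G t r × r t ≡ v × Evades t c r)
  uncaught⇒evades zero v (v≢c , _) =
    (λ _ → v) , (λ _ ()) , refl , (λ { zero _ → v≢c }) , (λ _ ())
  uncaught⇒evades {c} (suc t) v (v≢c , u , U , u≢c , u~v)
    with uncaught⇒evades t u U
  ... | r , lw , refl , ≢c , ≢c⁺ = r⁺ , lw⁺ , extend-suc r t v , ≢c₊ , ≢c⁺₊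
    where
    r⁺ : ℕ → V
    r⁺ = extend r t v

    lw⁺ : LazyWalk G (suc t) r⁺
    lw⁺ i (s≤s i≤t) with m≤n⇒m<n∨m≡n i≤t
    ... | inj₁ i<t rewrite extend-≤ r t v (<⇒≤ i<t) | extend-≤ r t v i<t = lw i i<t
    ... | inj₂ refl rewrite extend-≤ r t v (≤-refl {t}) | extend-suc r t v = u~v

    ≢c₊ : ∀ i → i ≤ suc t → r⁺ i ≢ c i
    ≢c₊ i i≤t+1 with m≤n⇒m<n∨m≡n i≤t+1
    ... | inj₁ (s≤s i≤t) rewrite extend-≤ r t v i≤t = ≢c i i≤t
    ... | inj₂ refl rewrite extend-suc r t v = v≢c

    ≢c⁺₊ : ∀ i → i < suc t → r⁺ i ≢ c (suc i)
    ≢c⁺₊ i (s≤s i≤t) with m≤n⇒m<n∨m≡n i≤t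
    ... | inj₁ i<t rewrite extend-≤ r t v (<⇒≤ i<t) = ≢c⁺ i i<t
    ... | inj₂ refl rewrite extend-≤ r t v (≤-refl {t}) = u≢c

  DistLe-0⇒≡ : ∀ {u v} → DistLe G u v 0 → u ≡ v
  DistLe-0⇒≡ (.0 , z≤n , here) = refl

  evades⇒¬captures : ∀ {T c r} → Evades T c r → ¬ Captures G 0 T c r
  evades⇒¬captures (≢c , _)  (inj₁ (i , i≤T , d)) = ≢c i i≤T (sym (DistLe-0⇒≡ d))
  evades⇒¬captures (_ , ≢c⁺) (inj₂ (i , i<T , d)) = ≢c⁺ i i<T (sym (DistLe-0⇒≡ d))

  captures⊎evades : ∀ T c r → Captures G 0 T c r ⊎ Evades T c r
  captures⊎evades T c r
    with anyUpTo? (λ i → c i ≟ᶠ r i) (suc T) | anyUpTo? (λ i → c (suc i) ≟ᶠ r i) T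
  ... | yes (i , s≤s i≤T , eq) | _ = inj₁ (inj₁ (i , i≤T , 0 , z≤n , subst (λ v → Walk G (c i) v 0) eq here))
  ... | _ | yes (i , i<T , eq) = inj₁ (inj₂ (i , i<T , 0 , z≤n , subst (λ v → Walk G (c (suc i)) v 0) eq here))
  ... | no ¬meet | no ¬meet⁺ =
    inj₂ ((λ i i≤T eq → ¬meet (i , s≤s i≤T , sym eq)) , (λ i i<T eq → ¬meet⁺ (i , i<T , sym eq)))

  ¬CopWins-if-always-uncaught : (∀ T c → LazyWalk G T c → ∃ (Uncaught Anywhere c T)) → ¬ CopWins G 0
  ¬CopWins-if-always-uncaught escape (T , c , lw , wins)
    with escape T c lw
  ... | v , U with uncaught⇒evades T v U
  ... | r , lwr , _ , ev = evades⇒¬captures ev (wins r lwr)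

  Sweep : (V → Set) → List V → V → Set
  Sweep = foldl Next

  Next-mono : ∀ {A B} w → A ⊆ B → Next A w ⊆ Next B w
  Next-mono w A⊆B (v≢w , u , Au , u≢w , u~v) = v≢w , u , A⊆B Au , u≢w , u~v

  Sweep-mono : ∀ {A B} ws → A ⊆ B → Sweep A ws ⊆ Sweep B ws
  Sweep-mono []       A⊆B = A⊆B
  Sweep-mono (w ∷ ws) A⊆B = Sweep-mono ws (Next-mono w A⊆B)

  patrol : V → List V → ℕ → V
  patrol w ws        zero    = w
  patrol w []        (suc i) = w
  patrol w (w′ ∷ ws) (suc i) = patrol w′ ws i

  patrol-lazy : ∀ w ws → Linked Near (w ∷ ws) → LazyWalk G (length ws) (patrol w ws)
  patrol-lazy w (w′ ∷ ws) (w~w′ ∷ _)  zero    _         = w~w′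
  patrol-lazy w (w′ ∷ ws) (_ ∷ links) (suc i) (s≤s i<n) = patrol-lazy w′ ws links i i<n

  Uncaught-suc : ∀ A c t → Uncaught A c (suc t) ≡ Uncaught (Next A (c 0)) (λ i → c (suc i)) t
  Uncaught-suc A c zero    = refl
  Uncaught-suc A c (suc t) = cong (λ X → Next X (c (suc (suc t)))) (Uncaught-suc A c t)

  Uncaught-patrol : ∀ A w ws → Uncaught A (patrol w ws) (length ws) ≡ Sweep A (w ∷ ws)
  Uncaught-patrol A w []        = refl
  Uncaught-patrol A w (w′ ∷ ws) =
    trans (Uncaught-suc A (patrol w (w′ ∷ ws)) (length ws)) (Uncaught-patrol (Next A w) w′ ws)

  CopWins-if-sweep-empty : ∀ w ws → Linked Near (w ∷ ws) → (∀ v → ¬ Sweep Anywhere (w ∷ ws) v) → CopWins G 0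
  CopWins-if-sweep-empty w ws links empty = length ws , patrol w ws , patrol-lazy w ws links , capture
    where
    capture : ∀ r → LazyWalk G (length ws) r → Captures G 0 (length ws) (patrol w ws) r
    capture r lw with captures⊎evades (length ws) (patrol w ws) r
    ... | inj₁ cap = cap
    ... | inj₂ ev  = ⊥-elim (empty _ (subst (λ X → X (r (length ws))) (Uncaught-patrol Anywhere w ws)
                                         (evades⇒uncaught lw ev (length ws) ≤-refl)))

  -- Cycles

  adj⇒≢ : ∀ {u v} → Adj u v → u ≢ v
  adj⇒≢ u~v refl = irrefl u~v

  TwoNeighbours : (V → Set) → Set
  TwoNeighbours C = ∀ {v} → C v → ∃[ u ] ∃[ w ] (C u × C w × u ≢ w × Adj u v × Adj w v)

  module _ {C : V → Set} (two : TwoNeighbours C) where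

    -- If the cop stood on v at time t, the robber reaches v from whichever of
    -- its two neighbours in C the cop does not step onto.
    uncaught-in : ∀ c t {v} → C v → v ≢ c t → Uncaught Anywhere c t v
    uncaught-in c zero    _ v≢c = v≢c , _ , tt , v≢c , inj₁ refl
    uncaught-in c (suc t) {v} Cv v≢c with v ≟ᶠ c t
    ... | no v≢c₀ = v≢c , v , uncaught-in c t Cv v≢c₀ , v≢c , inj₁ refl
    ... | yes refl with two Cv
    ...   | u , w , Cu , Cw , u≢w , u~v , w~v with u ≟ᶠ c (suc t)
    ...     | no u≢c  = v≢c , u , uncaught-in c t Cu (adj⇒≢ u~v) , u≢c , inj₂ u~v
    ...     | yes u≡c =
      v≢c , w , uncaught-in c t Cw (adj⇒≢ w~v) , (λ w≡c → u≢w (trans u≡c (sym w≡c))) , inj₂ w~v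

    uncaught-somewhere : ∀ {v} → C v → ∀ T c → ∃ (Uncaught Anywhere c T)
    uncaught-somewhere Cv T c with two Cv
    ... | u , w , Cu , Cw , u≢w , _ with u ≟ᶠ c T
    ...   | no u≢c  = u , uncaught-in c T Cu u≢c
    ...   | yes u≡c = w , uncaught-in c T Cw (λ w≡c → u≢w (trans u≡c (sym w≡c)))

  IsCycle-rotate : ∀ {x z} ys zs → IsCycle G x (ys ++ z ∷ zs) → IsCycle G z (zs ++ x ∷ ys)
  IsCycle-rotate {x} {z} ys zs (long , uniq , links) =
    subst (2 ≤_) same-length long ,
    Unique-++-comm (x ∷ ys) (z ∷ zs) uniq ,
    subst (λ L → Linked Adj (z ∷ L)) (sym (++-assoc zs (x ∷ ys) [ z ]))
      (Linked-join (z ∷ zs) (proj₂ halves) (proj₁ halves))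
    where
    same-length : length (ys ++ z ∷ zs) ≡ length (zs ++ x ∷ ys)
    same-length = trans (length-++-sucʳ ys z zs) (trans (cong suc (length-++-comm ys zs)) (sym (length-++-sucʳ zs x ys)))

    halves : Linked Adj (x ∷ ys ++ [ z ]) × Linked Adj (z ∷ zs ++ [ x ])
    halves = Linked-split (x ∷ ys) (subst (λ L → Linked Adj (x ∷ L)) (++-assoc ys (z ∷ zs) [ x ]) links)

  IsCycle-from : ∀ {x xs v} → IsCycle G x xs → v ∈ x ∷ xs →
                 ∃[ ws ] (IsCycle G v ws × (∀ {w} → w ∈ ws → w ∈ x ∷ xs))
  IsCycle-from {xs = xs} cyc (here refl) = xs , cyc , there
  IsCycle-from {x} cyc (there v∈xs) with ∈-∃++ v∈xs
  ... | ys , zs , refl = zs ++ x ∷ ys , IsCycle-rotate ys zs cyc ,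
                         λ w∈ → ∈-resp-↭ (++-comm (_ ∷ zs) (x ∷ ys)) (there w∈)

  IsCycle-head-neighbours : ∀ {v ws} → IsCycle G v ws →
                            ∃[ s ] ∃[ t ] (s ∈ ws × t ∈ ws × s ≢ t × Adj s v × Adj t v)
  IsCycle-head-neighbours {v} {s ∷ ws} (long , _ ∷ uniq , links) with initLast ws
  IsCycle-head-neighbours (s≤s () , _) | []
  ... | m ∷ʳ′ t = s , t , here refl , there t∈ , s≢t , adj-sym (Linked.head links) , Linked.head last-link
    where
    t∈ : t ∈ m ++ [ t ]
    t∈ = ∈-++⁺ʳ m (here refl)

    s≢t : s ≢ t
    s≢t refl = Unique[x∷xs]⇒x∉xs uniq t∈

    last-link : Linked Adj (t ∷ [ v ])
    last-link = proj₂ (Linked-split (v ∷ s ∷ m)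
                  (subst (λ L → Linked Adj (v ∷ s ∷ L)) (++-assoc m [ t ] [ v ]) links))

  cycle-TwoNeighbours : ∀ {x xs} → IsCycle G x xs → TwoNeighbours (_∈ x ∷ xs)
  cycle-TwoNeighbours cyc v∈ with IsCycle-from cyc v∈
  ... | ws , cyc′ , ⊆cyc with IsCycle-head-neighbours cyc′
  ...   | s , t , s∈ , t∈ , s≢t , s~v , t~v = s , t , ⊆cyc s∈ , ⊆cyc t∈ , s≢t , s~v , t~v

  CopWins⇒Acyclic : CopWins G 0 → Acyclic G
  CopWins⇒Acyclic wins x xs cyc =
    ¬CopWins-if-always-uncaught (λ T c _ → uncaught-somewhere (cycle-TwoNeighbours cyc) (here refl) T c) wins

  -- Trees and spiders

  Walk-snoc : ∀ {u v w k} → Walk G u v k → Adj v w → Walk G u w (suc k)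
  Walk-snoc here          v~w = step v~w here
  Walk-snoc (step u~x xs) v~w = step u~x (Walk-snoc xs v~w)

  Walk-reverse : ∀ {u v k} → Walk G u v k → Walk G v u k
  Walk-reverse here          = here
  Walk-reverse (step u~x xs) = Walk-snoc (Walk-reverse xs) (adj-sym u~x)

  lazy-segment : ∀ {T c} → LazyWalk G T c → ∀ i d → d + i ≤ T → ∃[ k ] (k ≤ d × Walk G (c i) (c (d + i)) k)
  lazy-segment lw i zero    _     = 0 , z≤n , here
  lazy-segment {c = c} lw i (suc d) bound with lazy-segment lw i d (<⇒≤ bound) | lw (d + i) bound
  ... | k , k≤d , walk | inj₁ eq  = k , m≤n⇒m≤1+n k≤d , subst (λ v → Walk G (c i) v k) eq walk
  ... | k , k≤d , walk | inj₂ adj = suc k , s≤s k≤d , Walk-snoc walk adj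

  Far : V → V → ℕ → Set
  Far u v d = ∀ {ℓ} → Walk G u v ℓ → d < ℓ

  record Spider : Set where
    field
      centre        : V
      middle leaf   : Fin 3 → V
      leaf~middle   : ∀ j → Adj (leaf j) (middle j)
      middle~centre : ∀ j → Adj (middle j) centre
      legs-distinct : ∀ {j k} → j ≢ k → Unique (leaf j ∷ middle j ∷ centre ∷ middle k ∷ leaf k ∷ [])

  module _ (acyclic : Acyclic G) where

    no-chord : ∀ {u s t} Y {Z} → Unique (u ∷ s ∷ Y ++ t ∷ Z) → Linked Adj (u ∷ s ∷ Y ++ t ∷ Z) → ¬ Adj t u
    no-chord {u} {s} {t} Y {Z} uniq links t~u = acyclic u (s ∷ Y ++ [ t ]) (long Y , uniq′ , links′)
      where
      split : u ∷ s ∷ Y ++ t ∷ Z ≡ (u ∷ s ∷ Y ++ [ t ]) ++ Z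
      split = cong (λ L → u ∷ s ∷ L) (sym (++-assoc Y [ t ] Z))

      long : ∀ Y → 2 ≤ length (s ∷ Y ++ [ t ])
      long []      = s≤s (s≤s z≤n)
      long (_ ∷ _) = s≤s (s≤s z≤n)

      uniq′ : Unique (u ∷ s ∷ Y ++ [ t ])
      uniq′ = Unique-++⁻ˡ (u ∷ s ∷ Y ++ [ t ]) (subst Unique split uniq)

      links′ : Linked Adj (u ∷ s ∷ (Y ++ [ t ]) ++ [ u ])
      links′ = subst (λ L → Linked Adj (u ∷ s ∷ L)) (sym (++-assoc Y [ t ] [ u ]))
                 (Linked-join (u ∷ s ∷ Y) (proj₁ (Linked-split (u ∷ s ∷ Y) links)) (t~u ∷ [-]))

    path-geodesic : ∀ {u v ℓ} P Q {R} → u ∷ P ≡ Q ++ v ∷ R → Unique (u ∷ P) → Linked Adj (u ∷ P) →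
                    Walk G u v ℓ → length Q ≤ ℓ
    path-geodesic P [] _ _ _ _ = z≤n
    path-geodesic P (q ∷ Q) eq uniq _ here =
      ⊥-elim (Unique[x∷xs]⇒x∉xs uniq (subst (_ ∈_) (sym (∷-injectiveʳ eq)) (∈-++⁺ʳ Q (here refl))))
    path-geodesic {u} P (q ∷ Q) eq uniq links (step {v = w} u~w walk) with w ∈? P
    ... | no w∉P =
      ≤-trans (n≤1+n _) (m≤n⇒m≤1+n
        (path-geodesic (u ∷ P) (w ∷ q ∷ Q) (cong (w ∷_) eq) uniq′ (adj-sym u~w ∷ links) walk))
      where
      uniq′ : Unique (w ∷ u ∷ P)
      uniq′ = ((λ w≡u → irrefl (subst (Adj u) w≡u u~w)) ∷ Allₚ.¬Any⇒All¬ P w∉P) ∷ uniq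
    ... | yes w∈P with ∈-∃++ w∈P
    ... | []    , Z , refl =
      s≤s (path-geodesic Z Q (∷-injectiveʳ eq) (AllPairs.tail uniq) (Linked.tail links) walk)
    ... | s ∷ Y , Z , refl = ⊥-elim (no-chord Y uniq links (adj-sym u~w))

    module _ (S : Spider) where
      open Spider S

      legs-linked : ∀ j k → Linked Adj (leaf j ∷ middle j ∷ centre ∷ middle k ∷ leaf k ∷ [])
      legs-linked j k = leaf~middle j ∷ middle~centre j ∷ adj-sym (middle~centre k) ∷ adj-sym (leaf~middle k) ∷ [-]

      far-leaf : ∀ {j k} → j ≢ k → Far (leaf j) (leaf k) 3
      far-leaf {j} {k} j≢k =
        path-geodesic _ (leaf j ∷ middle j ∷ centre ∷ middle k ∷ []) refl (legs-distinct j≢k) (legs-linked j k)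

      far-middle : ∀ {j k} → j ≢ k → Far (leaf j) (middle k) 2
      far-middle {j} {k} j≢k =
        path-geodesic _ (leaf j ∷ middle j ∷ centre ∷ []) refl (legs-distinct j≢k) (legs-linked j k)

      far-centre : ∀ {j k} → j ≢ k → Far (leaf j) centre 1
      far-centre {j} {k} j≢k =
        path-geodesic _ (leaf j ∷ middle j ∷ []) refl (legs-distinct j≢k) (legs-linked j k)

      leaves-distinct : ∀ {j k} → j ≢ k → leaf j ≢ leaf k
      leaves-distinct {j} j≢k eq with far-leaf j≢k (subst (λ v → Walk G (leaf j) v 0) eq here)
      ... | ()

      module _ {T : ℕ} {c : ℕ → V} (lw : LazyWalk G T c) where

        far-after : ∀ {σ m v e} d → d ≤ e → c σ ≡ leaf m → d + σ ≤ T → Far (leaf m) v e → v ≢ c (d + σ)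
        far-after {σ} d d≤e cσ bound far refl with lazy-segment lw σ d bound
        ... | ℓ , ℓ≤d , walk = <⇒≱ (far (subst (λ u → Walk G u _ ℓ) cσ walk)) (≤-trans ℓ≤d d≤e)

        far-before : ∀ {s m v e} d → d ≤ e → c (d + s) ≡ leaf m → d + s ≤ T → Far (leaf m) v e → v ≢ c s
        far-before {s} d d≤e cσ bound far refl with lazy-segment lw s d bound
        ... | ℓ , ℓ≤d , walk =
          <⇒≱ (far (subst (λ u → Walk G u _ ℓ) cσ (Walk-reverse walk))) (≤-trans ℓ≤d d≤e)

        leaf-visits-apart : ∀ {s₁ s₂ p q} → p ≢ q → s₁ ≤ s₂ → s₂ ≤ T →
                            c s₁ ≡ leaf p → c s₂ ≡ leaf q → 4 + s₁ ≤ s₂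
        leaf-visits-apart {s₁} {s₂} {p} {q} p≢q s₁≤s₂ s₂≤T cp cq
          with lazy-segment lw s₁ (s₂ ∸ s₁) (subst (_≤ T) (sym (m∸n+n≡m s₁≤s₂)) s₂≤T)
        ... | ℓ , ℓ≤d , walk =
          subst (4 + s₁ ≤_) (m∸n+n≡m s₁≤s₂) (+-monoˡ-≤ s₁ (≤-trans (far-leaf p≢q walk′) ℓ≤d))
          where
          walk′ : Walk G (leaf p) (leaf q) ℓ
          walk′ = subst₂ (λ u v → Walk G u v ℓ) cp (trans (cong c (m∸n+n≡m s₁≤s₂)) cq) walk

        -- The cop, at leaf m at time s + 2, is within distance 1, 0, 1, 2 of leaf m at times s + 1 … s + 4,
        -- while the robber's route leaf j, middle j, centre, middle k, leaf k keeps distance 4, 3, 2, 3, 4.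
        hop : ∀ {j m k s} → m ≢ j → m ≢ k → c (2 + s) ≡ leaf m → 4 + s ≤ T →
              Uncaught Anywhere c s (leaf j) → Uncaught Anywhere c (4 + s) (leaf k)
        hop {j} {m} {k} {s} m≢j m≢k cm bound U₀ = U₄
          where
          bound₂ : 2 + s ≤ T
          bound₂ = ≤-trans (m≤n+m (2 + s) 2) bound

          bound₃ : 3 + s ≤ T
          bound₃ = ≤-trans (n≤1+n (3 + s)) bound

          U₁ : Uncaught Anywhere c (1 + s) (middle j)
          U₁ = Uncaught-move {t = s} U₀ (inj₂ (leaf~middle j))
                 (far-before 1 (s≤s z≤n) cm bound₂ (far-leaf m≢j))
                 (far-before 1 (s≤s z≤n) cm bound₂ (far-middle m≢j))

          U₂ : Uncaught Anywhere c (2 + s) centre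
          U₂ = Uncaught-move {t = 1 + s} U₁ (inj₂ (middle~centre j))
                 (far-after 0 z≤n cm bound₂ (far-middle m≢j))
                 (far-after 0 z≤n cm bound₂ (far-centre m≢j))

          U₃ : Uncaught Anywhere c (3 + s) (middle k)
          U₃ = Uncaught-move {t = 2 + s} U₂ (inj₂ (adj-sym (middle~centre k)))
                 (far-after 1 ≤-refl cm bound₃ (far-centre m≢j))
                 (far-after 1 (s≤s z≤n) cm bound₃ (far-middle m≢k))

          U₄ : Uncaught Anywhere c (4 + s) (leaf k)
          U₄ = Uncaught-move {t = 3 + s} U₃ (inj₂ (adj-sym (leaf~middle k)))
                 (far-after 2 ≤-refl cm bound (far-middle m≢k))
                 (far-after 2 (s≤s (s≤s z≤n)) cm bound (far-leaf m≢k))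

        Never : ℕ → Fin 3 → Set
        Never t j = ∀ s → t ≤ s → s ≤ T → c s ≢ leaf j

        record FirstVisit (t : ℕ) (j : Fin 3) (τ : ℕ) : Set where
          constructor visit
          field
            from   : t ≤ τ
            within : τ ≤ T
            at     : c τ ≡ leaf j
            before : ∀ s → t ≤ s → s < τ → c s ≢ leaf j

        VisitsOther : Fin 3 → ℕ → Set
        VisitsOther j σ = ∃[ m ] (m ≢ j × c σ ≡ leaf m)

        Escapable : ℕ → Fin 3 → Set
        Escapable t j = Never t j ⊎ ∃[ τ ] (FirstVisit t j τ × ∃[ σ ] (2 + t ≤ σ × σ < τ × VisitsOther j σ))

        first-visit : ∀ t j → Never t j ⊎ ∃ (FirstVisit t j)
        first-visit t j with least-below (λ s → (t ≤? s) ×-dec (c s ≟ᶠ leaf j)) (suc T)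
        ... | inj₁ none = inj₁ (λ s t≤s s≤T cs → none s (s≤s s≤T) (t≤s , cs))
        ... | inj₂ (τ , s≤s τ≤T , (t≤τ , cτ) , below) =
          inj₂ (τ , visit t≤τ τ≤T cτ (λ s t≤s s<τ cs → below s s<τ (t≤s , cs)))

        visits-other? : ∀ j σ → Dec (VisitsOther j σ)
        visits-other? j σ = any? (λ m → ¬? (m ≟ᶠ j) ×-dec (c σ ≟ᶠ leaf m))

        -- The robber waits at leaf j and hops at the cop's last visit σ to another leaf m before his next
        -- visit τ to leaf j.  He lands on the third leaf k, which the cop does not visit between σ and τ,
        -- so the visit τ to leaf j, at least four steps after σ, makes leaf k escapable in turn.
        escape : ∀ fuel t j → T ≤ fuel + t → t ≤ T → Uncaught Anywhere c t (leaf j) → Escapable t j →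
                 ∃ (Uncaught Anywhere c T)
        escape _ t j _ t≤T U (inj₁ never) = leaf j , Uncaught-stay t≤T (λ s t<s s≤T → never s (<⇒≤ t<s) s≤T) U
        escape zero t j T≤t _ _ (inj₂ (τ , visit _ τ≤T _ _ , σ , 2+t≤σ , σ<τ , _)) =
          ⊥-elim (<⇒≱ (<-trans (≤-trans (m≤n+m (suc t) 1) 2+t≤σ) σ<τ) (≤-trans τ≤T T≤t))
        escape (suc fuel) t j bound _ U (inj₂ (τ , visit _ τ≤T cτ before-τ , σ₀ , 2+t≤σ₀ , σ₀<τ , other₀))
          with greatest-below (visits-other? j) τ 2+t≤σ₀ σ₀<τ other₀
        ... | suc (suc s) , s≤s (s≤s t≤s) , σ<τ , (m , m≢j , cσ) , last with third j m
        ...   | k , k≢j , k≢m = continue (first-visit (4 + s) k)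
          where
          apart : 4 + (2 + s) ≤ τ
          apart = leaf-visits-apart m≢j (<⇒≤ σ<τ) τ≤T cσ cτ

          4+s≤T : 4 + s ≤ T
          4+s≤T = ≤-trans (m≤n+m (4 + s) 2) (≤-trans apart τ≤T)

          bound′ : T ≤ fuel + (4 + s)
          bound′ = ≤-trans bound (≤-trans (≤-reflexive (sym (+-suc fuel t)))
                                           (+-monoʳ-≤ fuel (≤-trans (s≤s t≤s) (m≤n+m (suc s) 3))))

          U′ : Uncaught Anywhere c (4 + s) (leaf k)
          U′ = hop m≢j (≢-sym k≢m) cσ 4+s≤T (Uncaught-stay t≤s (λ s′ t<s′ s′≤s → before-τ s′ (<⇒≤ t<s′) (s′<τ s′≤s)) U)
            where
            s′<τ : ∀ {s′} → s′ ≤ s → s′ < τ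
            s′<τ s′≤s = ≤-trans (s≤s s′≤s) (≤-trans (n≤1+n (suc s)) (<⇒≤ σ<τ))

          continue : Never (4 + s) k ⊎ ∃ (FirstVisit (4 + s) k) → ∃ (Uncaught Anywhere c T)
          continue (inj₁ never) = escape fuel (4 + s) k bound′ 4+s≤T U′ (inj₁ never)
          continue (inj₂ (τ₂ , first₂@(visit 4+s≤τ₂ _ cτ₂ _))) with <-cmp τ τ₂
          ... | tri< τ<τ₂ _ _ =
            escape fuel (4 + s) k bound′ 4+s≤T U′ (inj₂ (τ₂ , first₂ , τ , apart , τ<τ₂ , j , ≢-sym k≢j , cτ))
          ... | tri≈ _ refl _ = ⊥-elim (leaves-distinct k≢j (trans (sym cτ₂) cτ))
          ... | tri> _ _ τ₂<τ =
            ⊥-elim (last τ₂ (≤-trans (s≤s (s≤s (n≤1+n (suc s)))) 4+s≤τ₂) τ₂<τ (k , k≢j , cτ₂))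

        start : ∀ {j} → c 0 ≢ leaf j → Uncaught Anywhere c 0 (leaf j)
        start c≢leaf = ≢-sym c≢leaf , _ , tt , ≢-sym c≢leaf , inj₁ refl

        escape-visited : (∀ j → ∃ (FirstVisit 0 j)) → ∃ (Uncaught Anywhere c T)
        escape-visited visits = from-order (sort3 τ τ-injective)
          where
          τ : Fin 3 → ℕ
          τ j = proj₁ (visits j)

          first : ∀ j → FirstVisit 0 j (τ j)
          first j = proj₂ (visits j)

          τ-injective : ∀ {p q} → p ≢ q → τ p ≢ τ q
          τ-injective {p} {q} p≢q eq =
            leaves-distinct p≢q (trans (sym (FirstVisit.at (first p))) (trans (cong c eq) (FirstVisit.at (first q))))

          from-order : ∃[ l ] ∃[ m ] ∃[ j ] (τ l < τ m × τ m < τ j × l ≢ m × m ≢ j) →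
                       ∃ (Uncaught Anywhere c T)
          from-order (l , m , j , τl<τm , τm<τj , l≢m , m≢j) =
            escape T 0 j (≤-reflexive (sym (+-identityʳ T))) z≤n
              (start (FirstVisit.before (first j) 0 z≤n (≤-trans (s≤s z≤n) τm<τj)))
              (inj₂ (τ j , first j , τ m , 2≤τm , τm<τj , m , m≢j , FirstVisit.at (first m)))
            where
            2≤τm : 2 ≤ τ m
            2≤τm = ≤-trans (m≤m+n 2 (2 + τ l))
                     (leaf-visits-apart l≢m (<⇒≤ τl<τm) (FirstVisit.within (first m))
                                        (FirstVisit.at (first l)) (FirstVisit.at (first m)))

        robber-escapes : ∃ (Uncaught Anywhere c T)
        robber-escapes with ∃⊎∀ (first-visit 0)
        ... | inj₁ (j , never) =
          escape T 0 j (≤-reflexive (sym (+-identityʳ T))) z≤n (start (never 0 z≤n z≤n)) (inj₁ never)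
        ... | inj₂ visits = escape-visited visits

      Spider⇒¬CopWins : ¬ CopWins G 0
      Spider⇒¬CopWins = ¬CopWins-if-always-uncaught (λ _ _ lw → robber-escapes lw)

    -- Caterpillars

    module _ {p : List V} (uniq : Unique p) (links : Linked Adj p) where

      Segment : V → V → Set
      Segment a b = ∃[ Y ] ( Unique (a ∷ Y ++ [ b ]) × Linked Adj (a ∷ Y ++ [ b ])
                           × (∀ {v} → v ∈ a ∷ Y ++ [ b ] → v ∈ p))

      infix-segment : ∀ X Y {a b Z} → p ≡ X ++ a ∷ Y ++ b ∷ Z → Segment a b
      infix-segment X Y {a} {b} {Z} eq = Y , uniq′ , links′ , ⊆p
        where
        regroup : p ≡ X ++ (a ∷ Y ++ [ b ]) ++ Z
        regroup = trans eq (cong (λ L → X ++ a ∷ L) (sym (++-assoc Y [ b ] Z)))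

        uniq′ : Unique (a ∷ Y ++ [ b ])
        uniq′ = Unique-++⁻ˡ (a ∷ Y ++ [ b ]) (Unique-++⁻ʳ X (subst Unique regroup uniq))

        links′ : Linked Adj (a ∷ Y ++ [ b ])
        links′ = proj₁ (Linked-split (a ∷ Y) (proj₂ (Linked-split X (subst (Linked Adj) eq links))))

        ⊆p : ∀ {v} → v ∈ a ∷ Y ++ [ b ] → v ∈ p
        ⊆p v∈ = subst (_ ∈_) (sym regroup) (∈-++⁺ʳ X (∈-++⁺ˡ v∈))

      Segment-reverse : ∀ {a b} → Segment b a → Segment a b
      Segment-reverse {a} {b} (Y , uniq′ , links′ , ⊆p) =
        reverse Y ,
        subst Unique flipped (Unique-reverse _ uniq′) ,
        subst (Linked Adj) flipped (Linked-reverse adj-sym links′) ,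
        λ v∈ → ⊆p (∈-resp-↭ (↭-reverse (b ∷ Y ++ [ a ])) (subst (_ ∈_) (sym flipped) v∈))
        where
        flipped : reverse (b ∷ Y ++ [ a ]) ≡ a ∷ reverse Y ++ [ b ]
        flipped = trans (reverse-split (b ∷ Y) a []) (cong (a ∷_) (unfold-reverse b Y))

      segment : ∀ {a b} → a ∈ p → b ∈ p → a ≢ b → Segment a b
      segment {a} {b} a∈ b∈ a≢b with ∈-∃++ a∈
      ... | X , R , p≡ with ∈-++⁻ X (subst (b ∈_) p≡ b∈)
      ...   | inj₂ (here b≡a) = ⊥-elim (a≢b (sym b≡a))
      ...   | inj₂ (there b∈R) with ∈-∃++ b∈R
      ...     | Y , Z , refl = infix-segment X Y p≡
      segment {a} {b} a∈ b∈ a≢b | X , R , p≡ | inj₁ b∈X with ∈-∃++ b∈X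
      ...     | X₁ , X₂ , refl = Segment-reverse (infix-segment X₁ X₂ (trans p≡ (++-assoc X₁ (b ∷ X₂) (a ∷ R))))

      off-path-attached-once : ∀ {v a b} → v ∉ p → Adj v a → Adj v b → a ∈ p → b ∈ p → a ≡ b
      off-path-attached-once {v} {a} {b} v∉ v~a v~b a∈ b∈ with a ≟ᶠ b
      ... | yes a≡b = a≡b
      ... | no  a≢b with segment a∈ b∈ a≢b
      ...   | Y , uniq′ , links′ , ⊆p =
        ⊥-elim (no-chord Y {[]} (Allₚ.¬Any⇒All¬ _ (λ v∈ → v∉ (⊆p v∈)) ∷ uniq′) (v~a ∷ links′)
                 (adj-sym v~b))

      off-path-edge-detached : ∀ {u v a b} → u ∉ p → v ∉ p → Adj u v → Adj u a → Adj v b →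
                               a ∈ p → b ∈ p → ⊥
      off-path-edge-detached {u} {v} {a} {b} u∉ v∉ u~v u~a v~b a∈ b∈ with b ≟ᶠ a
      ... | yes refl =
        no-chord [] {[]} ((adj⇒≢ u~v ∷ off u∉ a∈ ∷ []) ∷ (off v∉ a∈ ∷ []) ∷ [] ∷ []) (u~v ∷ v~b ∷ [-])
          (adj-sym u~a)
        where
        off : ∀ {w c} → w ∉ p → c ∈ p → w ≢ c
        off w∉ c∈ refl = w∉ c∈
      ... | no  b≢a with segment b∈ a∈ b≢a
      ...   | Y , uniq′ , links′ , ⊆p =
        no-chord (b ∷ Y) {[]} ((adj⇒≢ u~v ∷ outside u∉) ∷ outside v∉ ∷ uniq′) (u~v ∷ v~b ∷ links′)
          (adj-sym u~a)
        where
        outside : ∀ {w} → w ∉ p → All (w ≢_) (b ∷ Y ++ [ a ])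
        outside w∉ = Allₚ.¬Any⇒All¬ _ (λ w∈ → w∉ (⊆p w∈))

      no-jump : ∀ pre {q} post → p ≡ pre ++ q ∷ post → ∀ {u v} → u ∈ post → v ∈ pre → ¬ Adj u v
      no-jump pre {q} post p≡ {u} {v} u∈ v∈ u~v with ∈-∃++ v∈ | ∈-∃++ u∈
      ... | X , Y , refl | M , Z , refl =
        <⇒≱ long (path-geodesic _ (v ∷ Y ++ q ∷ M) regroup′ suffix-uniq suffix-links (step (adj-sym u~v) here))
        where
        regroup : p ≡ X ++ v ∷ Y ++ q ∷ M ++ u ∷ Z
        regroup = trans p≡ (++-assoc X (v ∷ Y) (q ∷ M ++ u ∷ Z))

        regroup′ : v ∷ Y ++ q ∷ M ++ u ∷ Z ≡ (v ∷ Y ++ q ∷ M) ++ u ∷ Z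
        regroup′ = cong (v ∷_) (sym (++-assoc Y (q ∷ M) (u ∷ Z)))

        suffix-uniq : Unique (v ∷ Y ++ q ∷ M ++ u ∷ Z)
        suffix-uniq = Unique-++⁻ʳ X (subst Unique regroup uniq)

        suffix-links : Linked Adj (v ∷ Y ++ q ∷ M ++ u ∷ Z)
        suffix-links = proj₂ (Linked-split X (subst (Linked Adj) regroup links))

        long : 1 < length (v ∷ Y ++ q ∷ M)
        long = s≤s (subst (1 ≤_) (sym (length-++-sucʳ Y q M)) (s≤s z≤n))

      module _ (dom : Dominates G p) where

        attachment : ∀ {v} → v ∉ p → ∃[ w ] (w ∈ p × Adj v w)
        attachment v∉ with find (dom _)
        ... | w , w∈ , inj₁ refl = ⊥-elim (v∉ w∈)
        ... | w , w∈ , inj₂ v~w  = w , w∈ , v~w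

        Leg : V → V → Set
        Leg q v = v ∉ p × Adj v q

        Leg? : ∀ q v → Dec (Leg q v)
        Leg? q v = ¬? (v ∈? p) ×-dec adj? v q

        -- Where an uncaught robber can still be once the cop has cleared everything before post.
        Ahead : List V → V → Set
        Ahead post v = v ∈ post ⊎ (v ∉ p × Any (Adj v) post)

        legs : V → List V
        legs q = filter (Leg? q) (allFin n)

        legs-are-legs : ∀ q → All (Leg q) (legs q)
        legs-are-legs q = Allₚ.all-filter (Leg? q) (allFin n)

        visit-all : V → List V → List V
        visit-all q []       = []
        visit-all q (l ∷ ls) = l ∷ q ∷ visit-all q ls

        route : List V → List V
        route []         = []
        route (q ∷ rest) = q ∷ visit-all q (legs q) ++ route rest

        module _ {pre q post} (p≡ : p ≡ pre ++ q ∷ post) where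

          q∈p : q ∈ p
          q∈p = subst (q ∈_) (sym p≡) (∈-++⁺ʳ pre (here refl))

          post⊆p : ∀ {w} → w ∈ post → w ∈ p
          post⊆p w∈ = subst (_ ∈_) (sym p≡) (∈-++⁺ʳ pre (there w∈))

          ahead-closed : ∀ {u v} → Ahead post u → Near u v → v ≢ q → Ahead post v
          ahead-closed ahead (inj₁ refl) _ = ahead
          ahead-closed {u} {v} (inj₁ u∈post) (inj₂ u~v) v≢q with v ∈? p
          ... | no v∉ = inj₂ (v∉ , Any.map (λ u≡w → subst (Adj v) u≡w (adj-sym u~v)) u∈post)
          ... | yes v∈ with ∈-++⁻ pre (subst (v ∈_) p≡ v∈)
          ...   | inj₁ v∈pre         = ⊥-elim (no-jump pre post p≡ u∈post v∈pre u~v)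
          ...   | inj₂ (here v≡q)    = ⊥-elim (v≢q v≡q)
          ...   | inj₂ (there v∈post) = inj₁ v∈post
          ahead-closed {u} {v} (inj₂ (u∉ , attached)) (inj₂ u~v) v≢q with find attached | v ∈? p
          ... | w , w∈post , u~w | yes v∈ =
            inj₁ (subst (_∈ post) (sym (off-path-attached-once u∉ u~v u~w v∈ (post⊆p w∈post))) w∈post)
          ... | w , w∈post , u~w | no v∉ with attachment v∉
          ...   | b , b∈ , v~b = ⊥-elim (off-path-edge-detached u∉ v∉ u~v u~w v~b (post⊆p w∈post) b∈)

          leg-stuck : ∀ {u v} → Leg q u → Near u v → v ≢ q → v ≡ u
          leg-stuck _ (inj₁ refl) _ = refl
          leg-stuck {u} {v} (u∉ , u~q) (inj₂ u~v) v≢q with v ∈? p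
          ... | yes v∈ = ⊥-elim (v≢q (off-path-attached-once u∉ u~v u~q v∈ q∈p))
          ... | no v∉ with attachment v∉
          ...   | b , b∈ , v~b = ⊥-elim (off-path-edge-detached u∉ v∉ u~v u~q v~b q∈p b∈)

          ahead-or-leg : ∀ {u} → Ahead (q ∷ post) u → u ≢ q → Ahead post u ⊎ Leg q u
          ahead-or-leg (inj₁ (here u≡q))         u≢q = ⊥-elim (u≢q u≡q)
          ahead-or-leg (inj₁ (there u∈post))     _   = inj₁ (inj₁ u∈post)
          ahead-or-leg (inj₂ (u∉ , here u~q))    _   = inj₂ (u∉ , u~q)
          ahead-or-leg (inj₂ (u∉ , there any))   _   = inj₁ (inj₂ (u∉ , any))

          Remaining : List V → V → Set
          Remaining ls v = Ahead post v ⊎ v ∈ ls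

          -- A leg is only left through q, so visiting a leg and returning to q clears it.
          visit-all-clears : ∀ ls → All (Leg q) ls → Sweep (Remaining ls) (visit-all q ls) ⊆ Ahead post
          visit-all-clears []       _                 (inj₁ ahead) = ahead
          visit-all-clears (l ∷ ls) (_ ∷ ls-legs) = visit-all-clears ls ls-legs ∘ Sweep-mono (visit-all q ls) round-trip
            where
            round-trip : Next (Next (Remaining (l ∷ ls)) l) q ⊆ Remaining ls
            round-trip {v₂} (v₂≢q , v , (v≢l , u , Ru , u≢l , u~v) , v≢q , v~v₂) with Ru
            ... | inj₁ ahead       = inj₁ (ahead-closed (ahead-closed ahead u~v v≢q) v~v₂ v₂≢q)
            ... | inj₂ (here refl) = ⊥-elim (u≢l refl)
            ... | inj₂ (there u∈ls) = inj₂ (subst (_∈ ls) (sym (trans v₂≡v v≡u)) u∈ls)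
              where
              v≡u : v ≡ u
              v≡u = leg-stuck (All.lookup ls-legs u∈ls) u~v v≢q

              v₂≡v : v₂ ≡ v
              v₂≡v = leg-stuck (subst (Leg q) (sym v≡u) (All.lookup ls-legs u∈ls)) v~v₂ v₂≢q

          enter : ∀ {A} → A ⊆ Ahead (q ∷ post) → Next A q ⊆ Remaining (legs q)
          enter A⊆ (v≢q , u , Au , u≢q , u~v) with ahead-or-leg (A⊆ Au) u≢q
          ... | inj₁ ahead = inj₁ (ahead-closed ahead u~v v≢q)
          ... | inj₂ leg   =
            inj₂ (subst (_∈ legs q) (sym (leg-stuck leg u~v v≢q)) (∈-filter⁺ (Leg? q) (∈-allFin _) leg))

        sweep-clears : ∀ pre q post → p ≡ pre ++ q ∷ post → ∀ {A} → A ⊆ Ahead (q ∷ post) →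
                       ∀ v → ¬ Sweep A (route (q ∷ post)) v
        sweep-past : ∀ pre q post → p ≡ pre ++ q ∷ post → ∀ {B} → B ⊆ Ahead post →
                     ∀ v → ¬ Sweep B (route post) v

        sweep-clears pre q post p≡ {A} A⊆ v S =
          sweep-past pre q post p≡ cleared v (subst (λ X → X v) (foldl-++ Next (Next A q) (visit-all q (legs q)) (route post)) S)
          where
          cleared : Sweep (Next A q) (visit-all q (legs q)) ⊆ Ahead post
          cleared = visit-all-clears p≡ (legs q) (legs-are-legs q) ∘ Sweep-mono (visit-all q (legs q)) (enter p≡ A⊆)

        sweep-past pre q [] _ B⊆ v Bv with B⊆ Bv
        ... | inj₁ ()
        ... | inj₂ (_ , ())
        sweep-past pre q (q₂ ∷ post) p≡ =
          sweep-clears (pre ++ [ q ]) q₂ post (trans p≡ (sym (++-assoc pre [ q ] (q₂ ∷ post))))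

        visit-all-linked : ∀ {q ys} ls → All (Leg q) ls → Linked Near (q ∷ ys) →
                           Linked Near (q ∷ visit-all q ls ++ ys)
        visit-all-linked []       _                     links′ = links′
        visit-all-linked (l ∷ ls) ((_ , l~q) ∷ ls-legs) links′ =
          inj₂ (adj-sym l~q) ∷ inj₂ l~q ∷ visit-all-linked ls ls-legs links′

        route-linked : ∀ q ps → Linked Adj (q ∷ ps) → Linked Near (q ∷ visit-all q (legs q) ++ route ps)
        route-linked q []        _               = visit-all-linked (legs q) (legs-are-legs q) [-]
        route-linked q (q₂ ∷ ps) (q~q₂ ∷ links′) =
          visit-all-linked (legs q) (legs-are-legs q) (inj₂ q~q₂ ∷ route-linked q₂ ps links′)

        route-wins : ∀ {q ps} → p ≡ q ∷ ps → CopWins G 0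
        route-wins {q} {ps} p≡ =
          CopWins-if-sweep-empty q (visit-all q (legs q) ++ route ps) (route-linked q ps (subst (Linked Adj) p≡ links))
            (sweep-clears [] q ps p≡ everywhere-ahead)
          where
          everywhere-ahead : Anywhere ⊆ Ahead (q ∷ ps)
          everywhere-ahead {v} _ with v ∈? p
          ... | yes v∈ = inj₁ (subst (v ∈_) p≡ v∈)
          ... | no v∉ with attachment v∉
          ...   | w , w∈ , v~w = inj₂ (v∉ , Any.map (λ w≡ → subst (Adj v) w≡ v~w) (subst (w ∈_) p≡ w∈))

  -- Dominating paths

  spider-from : ∀ {b₁ a₁ x a₂ b₂ y z} →
                Unique (b₁ ∷ a₁ ∷ x ∷ a₂ ∷ b₂ ∷ []) → Linked Adj (b₁ ∷ a₁ ∷ x ∷ a₂ ∷ b₂ ∷ []) →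
                y ∉ b₁ ∷ a₁ ∷ x ∷ a₂ ∷ b₂ ∷ [] → z ∉ b₁ ∷ a₁ ∷ x ∷ a₂ ∷ b₂ ∷ [] → Adj z y → Adj y x → Spider
  spider-from {b₁} {a₁} {x} {a₂} {b₂} {y} {z} uniq (b₁~a₁ ∷ a₁~x ∷ x~a₂ ∷ a₂~b₂ ∷ [-]) y∉ z∉ z~y y~x =
    record
    { centre        = x
    ; middle        = middle
    ; leaf          = leaf
    ; leaf~middle   = leaf~middle
    ; middle~centre = middle~centre
    ; legs-distinct = legs-distinct
    }
    where
    middle leaf : Fin 3 → V
    middle 0F = a₁
    middle 1F = a₂
    middle 2F = y
    leaf 0F = b₁
    leaf 1F = b₂
    leaf 2F = z

    leaf~middle : ∀ j → Adj (leaf j) (middle j)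
    leaf~middle 0F = b₁~a₁
    leaf~middle 1F = adj-sym a₂~b₂
    leaf~middle 2F = z~y

    middle~centre : ∀ j → Adj (middle j) x
    middle~centre 0F = a₁~x
    middle~centre 1F = adj-sym x~a₂
    middle~centre 2F = y~x

    with-branch : ∀ {b a} → Unique (b ∷ a ∷ x ∷ []) →
                  (∀ {v} → v ∈ b ∷ a ∷ x ∷ [] → v ∈ b₁ ∷ a₁ ∷ x ∷ a₂ ∷ b₂ ∷ []) →
                  Unique (b ∷ a ∷ x ∷ y ∷ z ∷ [])
    with-branch {b} {a} uniq′ ⊆seg = Unique.++⁺ uniq′ ((≢-sym (adj⇒≢ z~y) ∷ []) ∷ [] ∷ []) disjoint
      where
      disjoint : Disjoint (b ∷ a ∷ x ∷ []) (y ∷ z ∷ [])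
      disjoint (v∈ , here refl)         = y∉ (⊆seg v∈)
      disjoint (v∈ , there (here refl)) = z∉ (⊆seg v∈)

    leg-0-2 : Unique (b₁ ∷ a₁ ∷ x ∷ y ∷ z ∷ [])
    leg-0-2 = with-branch (Unique-++⁻ˡ (b₁ ∷ a₁ ∷ x ∷ []) uniq) ∈-++⁺ˡ

    leg-1-2 : Unique (b₂ ∷ a₂ ∷ x ∷ y ∷ z ∷ [])
    leg-1-2 = with-branch (Unique-++⁻ˡ (b₂ ∷ a₂ ∷ x ∷ []) (Unique-reverse _ uniq))
                (λ v∈ → ∈-resp-↭ (↭-reverse (b₁ ∷ a₁ ∷ x ∷ a₂ ∷ b₂ ∷ [])) (∈-++⁺ˡ v∈))

    legs-distinct : ∀ {j k} → j ≢ k → Unique (leaf j ∷ middle j ∷ x ∷ middle k ∷ leaf k ∷ [])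
    legs-distinct {0F} {1F} _ = uniq
    legs-distinct {1F} {0F} _ = Unique-reverse _ uniq
    legs-distinct {0F} {2F} _ = leg-0-2
    legs-distinct {2F} {0F} _ = Unique-reverse _ leg-0-2
    legs-distinct {1F} {2F} _ = leg-1-2
    legs-distinct {2F} {1F} _ = Unique-reverse _ leg-1-2
    legs-distinct {0F} {0F} j≢k = ⊥-elim (j≢k refl)
    legs-distinct {1F} {1F} j≢k = ⊥-elim (j≢k refl)
    legs-distinct {2F} {2F} j≢k = ⊥-elim (j≢k refl)

  IsPath-reverse : ∀ {p} → IsPath G p → IsPath G (reverse p)
  IsPath-reverse {p} (nonempty , uniq , links) =
    subst (0 <_) (sym (length-reverse p)) nonempty , Unique-reverse p uniq , Linked-reverse adj-sym links

  Longer : List V → Set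
  Longer p = ∃[ q ] (IsPath G q × length p < length q)

  extend-front : ∀ {z y x} pre post → IsPath G (pre ++ x ∷ post) → length pre ≤ 1 →
                 z ∉ pre ++ x ∷ post → y ∉ pre ++ x ∷ post → Adj z y → Adj y x → Longer (pre ++ x ∷ post)
  extend-front {z} {y} {x} pre post (_ , uniq , links) short z∉ y∉ z~y y~x =
    z ∷ y ∷ x ∷ post , (s≤s z≤n , uniq′ , z~y ∷ y~x ∷ proj₂ (Linked-split pre links)) , longer
    where
    off : ∀ {v} → v ∉ pre ++ x ∷ post → All (v ≢_) (x ∷ post)
    off v∉ = Allₚ.¬Any⇒All¬ (x ∷ post) (λ v∈ → v∉ (∈-++⁺ʳ pre v∈))

    uniq′ : Unique (z ∷ y ∷ x ∷ post)
    uniq′ = (adj⇒≢ z~y ∷ off z∉) ∷ off y∉ ∷ Unique-++⁻ʳ pre uniq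

    longer : length (pre ++ x ∷ post) < length (z ∷ y ∷ x ∷ post)
    longer = subst (_< 3 + length post) (sym (length-++ pre)) (+-monoˡ-≤ (suc (length post)) (s≤s short))

  extend-back : ∀ {z y x} pre post → IsPath G (pre ++ x ∷ post) → length post ≤ 1 →
                z ∉ pre ++ x ∷ post → y ∉ pre ++ x ∷ post → Adj z y → Adj y x → Longer (pre ++ x ∷ post)
  extend-back {z} {y} {x} pre post path short z∉ y∉ z~y y~x
    with extend-front (reverse post) (reverse pre) reversed (subst (_≤ 1) (sym (length-reverse post)) short)
                      (reversed-∉ z∉) (reversed-∉ y∉) z~y y~x
    where
    flipped : reverse (pre ++ x ∷ post) ≡ reverse post ++ x ∷ reverse pre
    flipped = reverse-split pre x post

    reversed : IsPath G (reverse post ++ x ∷ reverse pre)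
    reversed = subst (IsPath G) flipped (IsPath-reverse path)

    reversed-∉ : ∀ {v} → v ∉ pre ++ x ∷ post → v ∉ reverse post ++ x ∷ reverse pre
    reversed-∉ v∉ v∈ = v∉ (∈-resp-↭ (↭-reverse (pre ++ x ∷ post)) (subst (_ ∈_) (sym flipped) v∈))
  ... | q , path′ , longer =
    q , path′ , subst (_< length q) same-length longer
    where
    same-length : length (reverse post ++ x ∷ reverse pre) ≡ length (pre ++ x ∷ post)
    same-length = trans (cong length (sym (reverse-split pre x post))) (length-reverse (pre ++ x ∷ post))

  spider-or-longer : ∀ {z y} pre x post → IsPath G (pre ++ x ∷ post) →
                     z ∉ pre ++ x ∷ post → y ∉ pre ++ x ∷ post → Adj z y → Adj y x →
                     Spider ⊎ Longer (pre ++ x ∷ post)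
  spider-or-longer pre x []       path z∉ y∉ z~y y~x = inj₂ (extend-back pre [] path z≤n z∉ y∉ z~y y~x)
  spider-or-longer pre x (_ ∷ []) path z∉ y∉ z~y y~x = inj₂ (extend-back pre _ path (s≤s z≤n) z∉ y∉ z~y y~x)
  spider-or-longer pre x (a₂ ∷ b₂ ∷ post) path@(_ , uniq , links) z∉ y∉ z~y y~x with ends-with-two pre
  ... | inj₁ short = inj₂ (extend-front pre _ path short z∉ y∉ z~y y~x)
  ... | inj₂ (pre₀ , b₁ , a₁ , refl) =
    inj₁ (spider-from seg-uniq seg-links (λ v∈ → y∉ (seg⊆ v∈)) (λ v∈ → z∉ (seg⊆ v∈)) z~y y~x)
    where
    regroup : (pre₀ ++ b₁ ∷ a₁ ∷ []) ++ x ∷ a₂ ∷ b₂ ∷ post ≡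
              pre₀ ++ (b₁ ∷ a₁ ∷ x ∷ a₂ ∷ b₂ ∷ []) ++ post
    regroup = ++-assoc pre₀ (b₁ ∷ a₁ ∷ []) (x ∷ a₂ ∷ b₂ ∷ post)

    seg-uniq : Unique (b₁ ∷ a₁ ∷ x ∷ a₂ ∷ b₂ ∷ [])
    seg-uniq = Unique-++⁻ˡ (b₁ ∷ a₁ ∷ x ∷ a₂ ∷ b₂ ∷ []) (Unique-++⁻ʳ pre₀ (subst Unique regroup uniq))

    seg-links : Linked Adj (b₁ ∷ a₁ ∷ x ∷ a₂ ∷ b₂ ∷ [])
    seg-links = proj₁ (Linked-split (b₁ ∷ a₁ ∷ x ∷ a₂ ∷ [])
                  (proj₂ (Linked-split pre₀ (subst (Linked Adj) regroup links))))

    seg⊆ : ∀ {v} → v ∈ b₁ ∷ a₁ ∷ x ∷ a₂ ∷ b₂ ∷ [] →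
           v ∈ (pre₀ ++ b₁ ∷ a₁ ∷ []) ++ x ∷ a₂ ∷ b₂ ∷ post
    seg⊆ v∈ = subst (_ ∈_) (sym regroup) (∈-++⁺ʳ pre₀ (∈-++⁺ˡ v∈))

  Dominated : List V → V → Set
  Dominated p v = Any (λ w → v ≡ w ⊎ Adj v w) p

  dominated? : ∀ p v → Dec (Dominated p v)
  dominated? p v = Any.any? (λ w → (v ≟ᶠ w) ⊎-dec adj? v w) p

  ¬dominated⇒∉ : ∀ {p u} → ¬ Dominated p u → u ∉ p
  ¬dominated⇒∉ ¬dom u∈p = ¬dom (Any.map inj₁ u∈p)

  ¬dominated⇒neighbour-∉ : ∀ {p u v} → ¬ Dominated p u → Adj u v → v ∉ p
  ¬dominated⇒neighbour-∉ {u = u} ¬dom u~v v∈p = ¬dom (Any.map (λ v≡ → inj₂ (subst (Adj u) v≡ u~v)) v∈p)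

  branch-on-walk : ∀ p {u q k} → Walk G u q k → q ∈ p → ¬ Dominated p u →
                   ∃[ z ] ∃[ y ] ∃[ x ] (z ∉ p × y ∉ p × Adj z y × Adj y x × x ∈ p)
  branch-on-walk p here q∈p ¬dom = ⊥-elim (¬dominated⇒∉ ¬dom q∈p)
  branch-on-walk p {u} (step {v = u₁} u~u₁ walk) q∈p ¬dom with dominated? p u₁
  ... | no ¬dom₁ = branch-on-walk p walk q∈p ¬dom₁
  ... | yes dom₁ with find dom₁
  ...   | w , w∈p , inj₁ refl = ⊥-elim (¬dominated⇒neighbour-∉ ¬dom u~u₁ w∈p)
  ...   | w , w∈p , inj₂ u₁~w =
    u , u₁ , w , ¬dominated⇒∉ ¬dom , ¬dominated⇒neighbour-∉ ¬dom u~u₁ , u~u₁ , u₁~w , w∈p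

  nonempty⇒∃∈ : ∀ {p : List V} → 0 < length p → ∃ (_∈ p)
  nonempty⇒∃∈ {q ∷ _} _ = q , here refl

  dominates⊎spider⊎longer : Connected G → ∀ {p} → IsPath G p → Dominates G p ⊎ (Spider ⊎ Longer p)
  dominates⊎spider⊎longer (_ , connected) {p} path with all? (dominated? p)
  ... | yes dom = inj₁ dom
  ... | no ¬dom with ¬∀⟶∃¬ n (Dominated p) (dominated? p) ¬dom | nonempty⇒∃∈ (proj₁ path)
  ...   | v , ¬dom-v | q , q∈p with branch-on-walk p (proj₂ (connected v q)) q∈p ¬dom-v
  ...     | z , y , x , z∉ , y∉ , z~y , y~x , x∈p with ∈-∃++ x∈p
  ...       | pre , post , refl = inj₂ (spider-or-longer pre x post path z∉ y∉ z~y y~x)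

  module _ (connected : Connected G) (no-spider : ¬ Spider) where

    dominating-path-from : ∀ k {p} → IsPath G p → n < k + length p → ∃[ q ] (IsPath G q × Dominates G q)
    dominating-path-from zero    path@(_ , uniq , _) bound = ⊥-elim (<⇒≱ bound (injective⇒≤ (lookup-injective uniq)))
    dominating-path-from (suc k) {p} path bound with dominates⊎spider⊎longer connected path
    ... | inj₁ dom                 = p , path , dom
    ... | inj₂ (inj₁ spider)       = ⊥-elim (no-spider spider)
    ... | inj₂ (inj₂ (q , path′ , longer)) =
      dominating-path-from k path′ (≤-trans bound (subst (_≤ k + length q) (+-suc k (length p)) (+-monoʳ-≤ k longer)))

    dominating-path : ∃[ q ] (IsPath G q × Dominates G q)
    dominating-path = dominating-path-from n {[ v₀ ]} (s≤s z≤n , [] ∷ [] , [-]) (m<m+n n (s≤s z≤n))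
      where
      v₀ : V
      v₀ = fromℕ< (proj₁ connected)

  CopWins⇒IsCaterpillar : Connected G → CopWins G 0 → IsCaterpillar G
  CopWins⇒IsCaterpillar connected wins =
    (connected , acyclic) , dominating-path connected (λ S → Spider⇒¬CopWins acyclic S wins)
    where
    acyclic : Acyclic G
    acyclic = CopWins⇒Acyclic wins

  IsCaterpillar⇒CopWins : IsCaterpillar G → CopWins G 0
  IsCaterpillar⇒CopWins ((_ , acyclic) , q ∷ ps , (_ , uniq , links) , dom) = route-wins acyclic uniq links dom refl

theorem8 : (G : Graph) → Connected G → (RhoIs G 0 ⇔ IsCaterpillar G)
theorem8 G connected = mk⇔
  (λ ρ-is-0 → CopWins⇒IsCaterpillar G connected (proj₁ ρ-is-0))
  (λ caterpillar → IsCaterpillar⇒CopWins G caterpillar , λ _ _ → z≤n)
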